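{- Let $G=(V,E)$ be a directed out-forest with leaf set $\mathcal L$, and for $v\in V$ let $T_v$ be the vertex set of the subtree rooted at $v$ (including $v$). Let $c\ge1$, let $\lambda_i:V\to\{0,1,\dots,n\}$ for $1\le i\le c$, and let $k,m_2,\dots,m_c$ be numbers. Consider the linear program in variables $y_v$ ($v\in\mathcal L$) and $z_v$ ($v\in V\setminus\mathcal L$): $$\max\ \sum_{v\in\mathcal L}\lambda_1(v)y_v+\sum_{v\in V\setminus\mathcal L}\lambda_1(v)z_v$$ subject to $\sum_{v\in\mathcal L}\lambda_i(v)y_v+\sum_{v\in V\setminus\mathcal L}\lambda_i(v)z_v\ge m_i$ for $2\le i\le c$; $z_v\le\sum_{u\in T_v\cap\mathcal L}y_u$ for all $v\in V\setminus\mathcal L$; $\sum_{v\in\mathcal L}y_v\le k$; $0\le y_v\le 1$ for $v\in\mathcal L$; $0\le z_v\le1$ for $v\in V\setminus\mathcal L$. Then every extreme point solution $(y^*,z^*)$ of this LP has at most $2c$ leaves $v\in\mathcal L$ with $0<y^*_v<1$.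
   Context: A directed out-forest is a directed acyclic graph in which every vertex has in-degree at most one, so each weakly connected component is a rooted tree with all edges directed away from the root; leaves are the vertices with no outgoing edges.
   Formalization: The numbers k and $m_i$ and the variables $y_v$, $z_v$ are rational, and extremality of $(y^*,z^*)$ is tested only against rational feasible points. -}

module Defs where

open import Data.Nat as ℕ using (ℕ; zero; suc)
open import Data.Fin using (Fin; zero; suc; toℕ; fromℕ<)
open import Data.Fin.Properties using (_≟_)
open import Data.Bool using (Bool; true; false; _∧_; _∨_; not; T)
open import Data.Bool.Properties using (T?)
open import Data.List using (List; filter; length; foldr; map)
open import Data.Bool.ListAction using (any)
open import Data.List using () renaming (allFin to finList)
open import Data.Rational as ℚ using (ℚ; 0ℚ; 1ℚ; _+_; _*_; _-_; _≤_; _<_; _<?_)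
open import Data.Integer using (+_)
open import Data.Integer using (+_)
open import Data.Product using (_×_; _,_; Σ; ∃)
open import Relation.Nullary using (¬_; does)
open import Relation.Nullary.Decidable using (_×-dec_)
open import Relation.Binary.PropositionalEquality using (_≡_)
open import Relation.Binary.Construct.Closure.Transitive using (TransClosure)

Graph : ℕ → Set
Graph N = Fin N → Fin N → Bool

Edge : ∀ {N} → Graph N → Fin N → Fin N → Set
Edge E u v = T (E u v)

record IsOutForest {N : ℕ} (E : Graph N) : Set where
  field
    acyclic  : ∀ v → ¬ TransClosure (Edge E) v v
    inDeg≤1  : ∀ u u′ v → Edge E u v → Edge E u′ v → u ≡ u′

isLeaf : ∀ {N} → Graph N → Fin N → Bool
isLeaf {N} E v = not (any (λ u → E v u) (finList N))

reachWithin : ∀ {N} → Graph N → ℕ → Fin N → Fin N → Bool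
reachWithin E zero    v u = does (v ≟ u)
reachWithin {N} E (suc d) v u =
  does (v ≟ u) ∨ any (λ w → E v w ∧ reachWithin E d w u) (finList N)

-- u ∈ T_v : u is reachable from v (paths of length ≤ N suffice on N vertices);
-- T_v is the vertex set of the subtree rooted at v, including v.
inSubtree : ∀ {N} → Graph N → Fin N → Fin N → Bool
inSubtree {N} E v u = reachWithin E N v u

sumOver : ∀ {N} → (Fin N → Bool) → (Fin N → ℚ) → ℚ
sumOver {N} P f = foldr (λ v acc → (if P v then f v else 0ℚ) + acc) 0ℚ (finList N)
  where
  open import Data.Bool using (if_then_else_)

sumAll : ∀ {N} → (Fin N → ℚ) → ℚ
sumAll f = sumOver (λ _ → true) f

-- A point is a single vector x : Fin N → ℚ, where x v plays the
-- role of y_v for leaves v and of z_v for non-leaves v.  Note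
--   Σ_{v∈L} λ(v) y_v + Σ_{v∉L} λ(v) z_v = Σ_v λ(v) x_v.
-- Constraints are indexed by i : Fin c; index 0 is the objective
-- (λ_1 in the paper), indices i with toℕ i ≥ 1 are covering constraints.

weight : ∀ {N} → (Fin N → ℕ) → (Fin N → ℚ) → ℚ
weight lam x = sumAll (λ v → ((+ lam v) ℚ./ 1) * x v)

module _ {N c : ℕ} (E : Graph N) (lam : Fin c → Fin N → ℕ)
         (k : ℚ) (m : Fin c → ℚ) where

  -- objective: maximise  weight (lam objIndex) x  (irrelevant for extreme points)
  record Feasible (x : Fin N → ℚ) : Set where
    field
      cover   : ∀ (i : Fin c) → 1 ℕ.≤ toℕ i → m i ≤ weight (lam i) x
      zBound  : ∀ v → isLeaf E v ≡ false →
                x v ≤ sumOver (λ u → isLeaf E u ∧ inSubtree E v u) x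
      budget  : sumOver (isLeaf E) x ≤ k
      nonneg  : ∀ v → 0ℚ ≤ x v
      le1     : ∀ v → x v ≤ 1ℚ

  record ExtremePoint (x : Fin N → ℚ) : Set where
    field
      feasible : Feasible x
      extreme  : ∀ (x₁ x₂ : Fin N → ℚ) (t : ℚ) →
                 Feasible x₁ → Feasible x₂ → 0ℚ < t → t < 1ℚ →
                 (∀ v → x v ≡ t * x₁ v + (1ℚ - t) * x₂ v) →
                 ∀ v → x₁ v ≡ x₂ v

fractionalLeaves : ∀ {N} → Graph N → (Fin N → ℚ) → ℕ
fractionalLeaves {N} E x =
  length (filter (λ v → T? (isLeaf E v) ×-dec (0ℚ <? x v) ×-dec (x v <? 1ℚ)) (finList N))

-- An extreme point x admits no direction d ≠ 0 along which x + εd and x − εd both stay feasible for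
-- some ε > 0, and such a d exists as soon as d is flat on every constraint that x satisfies with
-- equality. We look for d among the vectors α supported on the fractional leaves, extended to each
-- internal vertex whose subtree constraint is tight and whose value is fractional by the sum of α over
-- its leaves. Flatness then asks: the leaf sum of α vanishes, the c − 1 covering constraints are flat,
-- and α sums to zero over the fractional leaves of every saturated subtree, one whose leaves carry
-- total mass 1. Saturated subtrees sharing a vertex have the same fractional leaves, so these leaves
-- fall into disjoint blocks, each of size at least 2 because one fractional leaf cannot complete mass 1
-- together with integral ones. With f fractional leaves this is a homogeneous system of at most
-- (N − f) + c + f/2 equations in N unknowns, which has a nonzero solution when f > 2c.

module Submission where

open import Defs
open import Algebra.Bundles using (Ring; CommutativeMonoid)
import Algebra.Properties.Semiring.Sum as SemiringSum
open import Data.Bool as Bool using (Bool; true; false; if_then_else_; T; not; _∧_)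
open import Data.Bool.Properties using (T-∧; T-∨; T?)
open import Data.Empty using (⊥; ⊥-elim)
open import Data.Fin as Fin using (Fin; zero; suc; toℕ; punchIn)
import Data.Fin.Properties as FinP
open import Data.List as List using (List; []; _∷_; tabulate; foldr; filter; length)
open import Data.List.Membership.Propositional using (lose)
open import Data.List.Membership.Propositional.Properties using (∈-allFin; ∈-filter⁺)
open import Data.List.Relation.Unary.All as All using (All; []; _∷_)
import Data.List.Relation.Unary.All.Properties as AllP
open import Data.List.Properties using (length-map; length-++; length-tabulate)
open import Data.List.Relation.Unary.Any using (satisfied)
open import Data.List.Relation.Unary.Any.Properties using (any⁺; any⁻)
open import Data.Nat as ℕ using (ℕ; zero; suc; z≤n; s≤s)
import Data.Nat.Properties as ℕP
open import Data.Product using (_×_; _,_; ∃; ∃₂; proj₁; proj₂)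
import Data.Integer as ℤ
open import Data.Rational as ℚ using (ℚ; 0ℚ; 1ℚ)
import Data.Rational.Properties as ℚP
open import Data.Sum using (_⊎_; inj₁; inj₂)
open import Data.Unit using (tt)
open import Data.Vec.Functional using (removeAt; insertAt)
import Data.Vec.Functional as Vector
open import Data.Vec.Functional.Properties using (insertAt-lookup; insertAt-punchIn)
open import Function using (_∘_; id)
open import Function.Bundles using (Equivalence)
open import Relation.Binary.Definitions using (tri<; tri≈; tri>)
open import Relation.Binary.PropositionalEquality
open import Relation.Binary.Construct.Closure.Transitive using (TransClosure; [_]; _∷_)
open import Relation.Nullary using (¬_; Dec; yes; no; does; ¬?)
open import Relation.Nullary.Decidable using (_×-dec_; _→-dec_)

does⇒witness : ∀ {A : Set} (a? : Dec A) → T (does a?) → A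
does⇒witness (yes a) _ = a

witness⇒does : ∀ {A : Set} (a? : Dec A) → A → T (does a?)
witness⇒does (yes _) _ = tt
witness⇒does (no ¬a) a = ¬a a

¬T⇒≡false : ∀ {b} → ¬ T b → b ≡ false
¬T⇒≡false {true}  ¬t = ⊥-elim (¬t tt)
¬T⇒≡false {false} _  = refl

module ℕΣ = SemiringSum ℕP.+-*-semiring

indicator : Bool → ℕ
indicator b = if b then 1 else 0

count : ∀ {n} → (Fin n → Bool) → ℕ
count p = ℕΣ.sum (λ i → indicator (p i))

length-filter-allFin : ∀ {n} {P : Fin n → Set} (P? : ∀ i → Dec (P i)) →
                       length (filter P? (List.allFin n)) ≡ count (λ i → does (P? i))
length-filter-allFin {n} P? = go n id
  where
  go : ∀ m (g : Fin m → Fin n) → length (filter P? (tabulate g)) ≡ count (λ i → does (P? (g i)))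
  go zero    g = refl
  go (suc m) g with does (P? (g zero))
  ... | true  = cong suc (go m (g ∘ suc))
  ... | false = go m (g ∘ suc)

count-complement : ∀ {n} (p : Fin n → Bool) → count (not ∘ p) ℕ.+ count p ≡ n
count-complement {zero}  p = refl
count-complement {suc n} p with p zero
... | true  = trans (ℕP.+-suc _ _) (cong suc (count-complement (p ∘ suc)))
... | false = cong suc (count-complement (p ∘ suc))

count-none : ∀ {n} (p : Fin n → Bool) → (∀ i → ¬ T (p i)) → count p ≡ 0
count-none {zero}  p ¬p = refl
count-none {suc n} p ¬p with p zero in p₀
... | true  = ⊥-elim (¬p zero (subst T (sym p₀) tt))
... | false = count-none (p ∘ suc) (¬p ∘ suc)

count≤1 : ∀ {n} (p : Fin n → Bool) → (∀ {i j} → T (p i) → T (p j) → i ≡ j) → count p ℕ.≤ 1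
count≤1 {zero}  p unique = z≤n
count≤1 {suc n} p unique with p zero in p₀
... | true  = ℕP.≤-reflexive (cong suc (count-none (p ∘ suc) λ i pᵢ → FinP.0≢1+n (unique (subst T (sym p₀) tt) pᵢ)))
... | false = count≤1 (p ∘ suc) (λ pᵢ pⱼ → FinP.suc-injective (unique pᵢ pⱼ))

1≤count : ∀ {n} (p : Fin n → Bool) {i} → T (p i) → 1 ℕ.≤ count p
1≤count {suc n} p {zero}  pᵢ with p zero
... | true = s≤s z≤n
1≤count {suc n} p {suc i} pᵢ = ℕP.≤-trans (1≤count (p ∘ suc) pᵢ) (ℕP.m≤n+m _ _)

2≤count : ∀ {n} (p : Fin n → Bool) {i j} → i ≢ j → T (p i) → T (p j) → 2 ℕ.≤ count p
2≤count {suc n} p {zero}  {zero}  i≢j pᵢ pⱼ = ⊥-elim (i≢j refl)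
2≤count {suc n} p {zero}  {suc j} i≢j pᵢ pⱼ with p zero
... | true = s≤s (1≤count (p ∘ suc) pⱼ)
2≤count {suc n} p {suc i} {zero}  i≢j pᵢ pⱼ with p zero
... | true = s≤s (1≤count (p ∘ suc) pᵢ)
2≤count {suc n} p {suc i} {suc j} i≢j pᵢ pⱼ =
  ℕP.≤-trans (2≤count (p ∘ suc) (i≢j ∘ cong suc) pᵢ pⱼ) (ℕP.m≤n+m _ _)

sumℕ-mono-≤ : ∀ {n} {f g : Fin n → ℕ} → (∀ i → f i ℕ.≤ g i) → ℕΣ.sum f ℕ.≤ ℕΣ.sum g
sumℕ-mono-≤ {zero}  f≤g = z≤n
sumℕ-mono-≤ {suc n} f≤g = ℕP.+-mono-≤ (f≤g zero) (sumℕ-mono-≤ (f≤g ∘ suc))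

double-count : ∀ {m n} (p : Fin m → Bool) (q : Fin n → Bool) (R : Fin m → Fin n → Bool) →
               (∀ {i} → T (p i) → ∃₂ λ j j′ → j ≢ j′ × T (R i j) × T (R i j′)) →
               (∀ {i i′ j} → T (R i j) → T (R i′ j) → i ≡ i′) →
               (∀ {i j} → T (R i j) → T (q j)) →
               count p ℕ.+ count p ℕ.≤ count q
double-count p q R twoPartners unique R⇒q = begin
  count p ℕ.+ count p                                  ≡⟨ ℕΣ.∑-distrib-+ (indicator ∘ p) (indicator ∘ p) ⟨
  ℕΣ.sum (λ i → indicator (p i) ℕ.+ indicator (p i))  ≤⟨ sumℕ-mono-≤ twice≤ ⟩
  ℕΣ.sum (λ i → count (R i))                           ≡⟨ ℕΣ.∑-comm (λ i j → indicator (R i j)) ⟩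
  ℕΣ.sum (λ j → count (λ i → R i j))                   ≤⟨ sumℕ-mono-≤ column≤ ⟩
  count q                                              ∎
  where
  open ℕP.≤-Reasoning
  twice≤ : ∀ i → indicator (p i) ℕ.+ indicator (p i) ℕ.≤ count (R i)
  twice≤ i with p i in pᵢ
  ... | false = z≤n
  ... | true with twoPartners (subst T (sym pᵢ) tt)
  ...   | j , j′ , j≢j′ , Rij , Rij′ = 2≤count (R i) j≢j′ Rij Rij′
  column≤ : ∀ j → count (λ i → R i j) ℕ.≤ indicator (q j)
  column≤ j with q j in qⱼ
  ... | true  = count≤1 (λ i → R i j) unique
  ... | false = ℕP.≤-reflexive (count-none (λ i → R i j) λ i Rij → subst T qⱼ (R⇒q Rij))

least-witness : ∀ {n} {P : Fin n → Set} → (∀ i → Dec (P i)) → ∀ {i} → P i →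
                ∃ λ h → P h × (∀ j → j Fin.< h → ¬ P j)
least-witness {suc n} P? {i} Pᵢ with P? zero | i
... | yes P₀ | _     = zero , P₀ , λ _ ()
... | no ¬P₀ | zero  = ⊥-elim (¬P₀ Pᵢ)
... | no ¬P₀ | suc _ with least-witness (P? ∘ suc) Pᵢ
...   | h , Pₕ , least = suc h , Pₕ , λ { zero _ → ¬P₀ ; (suc j) (s≤s j<h) → least j j<h }


module Walks {N : ℕ} (E : Graph N) where

  infixr 5 _∷_

  data Walk : Fin N → Fin N → ℕ → Set where
    []  : ∀ {v} → Walk v v 0
    _∷_ : ∀ {v w u L} → Edge E v w → Walk w u L → Walk v u (suc L)

  _++ʷ_ : ∀ {v w u a b} → Walk v w a → Walk w u b → Walk v u (a ℕ.+ b)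
  []      ++ʷ q = q
  (e ∷ p) ++ʷ q = e ∷ (p ++ʷ q)

  reachWithin⇒walk : ∀ d {v u} → T (reachWithin E d v u) → ∃ λ L → L ℕ.≤ d × Walk v u L
  reachWithin⇒walk zero    {v} {u} v≡u with refl ← does⇒witness (v FinP.≟ u) v≡u = 0 , z≤n , []
  reachWithin⇒walk (suc d) {v} {u} r with Equivalence.to (T-∨ {does (v FinP.≟ u)}) r
  ... | inj₁ v≡u with refl ← does⇒witness (v FinP.≟ u) v≡u = 0 , z≤n , []
  ... | inj₂ r′ with satisfied (any⁻ _ (List.allFin N) r′)
  ... | w , e∧r with Equivalence.to (T-∧ {E v w}) e∧r
  ... | e , r″ with reachWithin⇒walk d r″
  ... | L , L≤d , p = suc L , s≤s L≤d , e ∷ p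

  walk⇒reachWithin : ∀ d {v u L} → Walk v u L → L ℕ.≤ d → T (reachWithin E d v u)
  walk⇒reachWithin zero    {v} [] _ = witness⇒does (v FinP.≟ v) refl
  walk⇒reachWithin (suc d) {v} [] _ = Equivalence.from T-∨ (inj₁ (witness⇒does (v FinP.≟ v) refl))
  walk⇒reachWithin (suc d) {v} {u} (_∷_ {w = w} e p) (s≤s L≤d) =
    Equivalence.from (T-∨ {does (v FinP.≟ u)})
      (inj₂ (any⁺ _ (lose (∈-allFin w) (Equivalence.from T-∧ (e , walk⇒reachWithin d p L≤d)))))

  vertexAt : ∀ {v u L} → Walk v u L → ℕ → Fin N
  vertexAt {v} []          _       = v
  vertexAt {v} (_ ∷ _)     zero    = v
  vertexAt     (_ ∷ p)     (suc i) = vertexAt p i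

  vertexAt-zero : ∀ {v u L} (p : Walk v u L) → vertexAt p 0 ≡ v
  vertexAt-zero []      = refl
  vertexAt-zero (_ ∷ _) = refl

  segment⁺ : ∀ {v u L} (p : Walk v u L) {a b} → a ℕ.< b → b ℕ.≤ L →
             TransClosure (Edge E) (vertexAt p a) (vertexAt p b)
  segment⁺ (_∷_ {v} e p) {zero} {suc zero} _ _ = [ subst (Edge E v) (sym (vertexAt-zero p)) e ]
  segment⁺ (_∷_ {v} e p) {zero} {suc (suc b)} _ (s≤s b<L) =
    subst (Edge E v) (sym (vertexAt-zero p)) e ∷ segment⁺ p (s≤s z≤n) b<L
  segment⁺ (_ ∷ p) {suc a} {suc b} (s≤s a<b) (s≤s b≤L) = segment⁺ p a<b b≤L

  -- The vertices of a walk of length L ≥ N repeat, and the walk between repeats is a cycle.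
  acyclic⇒walk-short : (∀ v → ¬ TransClosure (Edge E) v v) → ∀ {v u L} → Walk v u L → L ℕ.< N
  acyclic⇒walk-short acyclic {L = L} p with L ℕ.<? N
  ... | yes L<N = L<N
  ... | no L≮N with FinP.pigeonhole (s≤s (ℕP.≮⇒≥ L≮N)) (λ (i : Fin (suc L)) → vertexAt p (toℕ i))
  ... | i , j , i<j , pᵢ≡pⱼ =
    ⊥-elim (acyclic _ (subst (TransClosure (Edge E) _) (sym pᵢ≡pⱼ)
                          (segment⁺ p i<j (ℕP.≤-pred (FinP.toℕ<n j)))))

module Subtrees {N : ℕ} {E : Graph N} (forest : IsOutForest E) where
  open Walks E
  open IsOutForest forest

  inSubtree⇒walk : ∀ {v u} → T (inSubtree E v u) → ∃ (Walk v u)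
  inSubtree⇒walk r with reachWithin⇒walk N r
  ... | L , _ , p = L , p

  walk⇒inSubtree : ∀ {v u L} → Walk v u L → T (inSubtree E v u)
  walk⇒inSubtree p = walk⇒reachWithin N p (ℕP.<⇒≤ (acyclic⇒walk-short acyclic p))

  subtree-trans : ∀ {v w u} → T (inSubtree E v w) → T (inSubtree E w u) → T (inSubtree E v u)
  subtree-trans r r′ with inSubtree⇒walk r | inSubtree⇒walk r′
  ... | _ , p | _ , q = walk⇒inSubtree (p ++ʷ q)

  unsnoc : ∀ {v u L} → Walk v u (suc L) → ∃ λ w → Walk v w L × Edge E w u
  unsnoc (e ∷ [])       = _ , [] , e
  unsnoc (e ∷ (e′ ∷ p)) with unsnoc (e′ ∷ p)
  ... | w , q , e″ = w , e ∷ q , e″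

  -- Walking backwards from a common endpoint, parents are unique.
  walks-nested : ∀ a b {v v′ u} → Walk v u a → Walk v′ u b → ∃ (Walk v′ v) ⊎ ∃ (Walk v v′)
  walks-nested zero    b       []  q  = inj₁ (b , q)
  walks-nested (suc a) zero    p   [] = inj₂ (suc a , p)
  walks-nested (suc a) (suc b) p   q with unsnoc p | unsnoc q
  ... | w , p′ , e | w′ , q′ , e′ with inDeg≤1 w w′ _ e e′
  ... | refl = walks-nested a b p′ q′

  subtrees-nested : ∀ {v v′ u} → T (inSubtree E v u) → T (inSubtree E v′ u) →
                    T (inSubtree E v′ v) ⊎ T (inSubtree E v v′)
  subtrees-nested r r′ with inSubtree⇒walk r | inSubtree⇒walk r′
  ... | a , p | b , q with walks-nested a b p q
  ... | inj₁ (_ , s) = inj₁ (walk⇒inSubtree s)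
  ... | inj₂ (_ , s) = inj₂ (walk⇒inSubtree s)

module Sums where
  open import Data.Rational using (_+_; _*_; _≤_)

  module ℚΣ = SemiringSum (Ring.semiring ℚP.+-*-ring)
  open ℚΣ using (sum)

  restrict : ∀ {n} → (Fin n → Bool) → (Fin n → ℚ) → Fin n → ℚ
  restrict P f v = if P v then f v else 0ℚ

  sumOver≡sum : ∀ {n} (P : Fin n → Bool) (f : Fin n → ℚ) → sumOver P f ≡ sum (restrict P f)
  sumOver≡sum {n} P f = go n id
    where
    go : ∀ m (g : Fin m → Fin n) → foldr (λ v acc → restrict P f v + acc) 0ℚ (tabulate g) ≡ sum (restrict P f ∘ g)
    go zero    g = refl
    go (suc m) g = cong (restrict P f (g zero) +_) (go m (g ∘ suc))

  sum-mono-≤ : ∀ {n} {f g : Fin n → ℚ} → (∀ i → f i ≤ g i) → sum f ≤ sum g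
  sum-mono-≤ {zero}  f≤g = ℚP.≤-refl
  sum-mono-≤ {suc n} f≤g = ℚP.+-mono-≤ (f≤g zero) (sum-mono-≤ (f≤g ∘ suc))

  sum-nonneg : ∀ {n} {f : Fin n → ℚ} → (∀ i → 0ℚ ≤ f i) → 0ℚ ≤ sum f
  sum-nonneg {n} {f} 0≤f = subst (_≤ sum f) (ℚΣ.sum-replicate-zero n) (sum-mono-≤ 0≤f)

  module _ {n : ℕ} (P : Fin n → Bool) where

    restrict-nonneg : ∀ {f : Fin n → ℚ} → (∀ u → 0ℚ ≤ f u) → ∀ u → 0ℚ ≤ restrict P f u
    restrict-nonneg 0≤f u with P u
    ... | true  = 0≤f u
    ... | false = ℚP.≤-refl

    restrict-T : ∀ (f : Fin n → ℚ) {u} → T (P u) → restrict P f u ≡ f u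
    restrict-T f {u} Pu with P u
    ... | true = refl

    restrict-F : ∀ (f : Fin n → ℚ) {u} → ¬ T (P u) → restrict P f u ≡ 0ℚ
    restrict-F f {u} ¬Pu with P u
    ... | true  = ⊥-elim (¬Pu tt)
    ... | false = refl

    restrict-zero : ∀ (f : Fin n → ℚ) {u} → f u ≡ 0ℚ → restrict P f u ≡ 0ℚ
    restrict-zero f {u} fu≡0 with P u
    ... | true  = fu≡0
    ... | false = refl

    sumOver-ext : ∀ {Q : Fin n → Bool} {f g : Fin n → ℚ} → (∀ u → restrict P f u ≡ restrict Q g u) →
                  sumOver P f ≡ sumOver Q g
    sumOver-ext {Q} {f} {g} pointwise = begin
      sumOver P f         ≡⟨ sumOver≡sum P f ⟩
      sum (restrict P f)  ≡⟨ ℚΣ.sum-cong-≗ pointwise ⟩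
      sum (restrict Q g)  ≡⟨ sumOver≡sum Q g ⟨
      sumOver Q g         ∎
      where open ≡-Reasoning

    sumOver-cong : ∀ {f g : Fin n → ℚ} → (∀ u → T (P u) → f u ≡ g u) → sumOver P f ≡ sumOver P g
    sumOver-cong {f} {g} f≡g = sumOver-ext {P} {g = g} pointwise
      where
      pointwise : ∀ u → restrict P f u ≡ restrict P g u
      pointwise u with P u | f≡g u
      ... | true  | eq = eq tt
      ... | false | _  = refl

    sumOver-zero : ∀ {f : Fin n → ℚ} → (∀ u → T (P u) → f u ≡ 0ℚ) → sumOver P f ≡ 0ℚ
    sumOver-zero {f} f≡0 =
      trans (sumOver-cong f≡0)
            (trans (sumOver≡sum P (λ _ → 0ℚ)) (trans (ℚΣ.sum-cong-≗ zeros) (ℚΣ.sum-replicate-zero n)))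
      where
      zeros : ∀ u → restrict P (λ _ → 0ℚ) u ≡ 0ℚ
      zeros u with P u
      ... | true  = refl
      ... | false = refl

    sumOver-+ : ∀ (f g : Fin n → ℚ) → sumOver P (λ v → f v + g v) ≡ sumOver P f + sumOver P g
    sumOver-+ f g = begin
      sumOver P (λ v → f v + g v)            ≡⟨ sumOver≡sum P _ ⟩
      sum (restrict P (λ v → f v + g v))     ≡⟨ ℚΣ.sum-cong-≗ pointwise ⟩
      sum (λ v → restrict P f v + restrict P g v) ≡⟨ ℚΣ.∑-distrib-+ (restrict P f) (restrict P g) ⟩
      sum (restrict P f) + sum (restrict P g) ≡⟨ cong₂ _+_ (sumOver≡sum P f) (sumOver≡sum P g) ⟨
      sumOver P f + sumOver P g              ∎
      where
      open ≡-Reasoning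
      pointwise : ∀ u → restrict P (λ v → f v + g v) u ≡ restrict P f u + restrict P g u
      pointwise u with P u
      ... | true  = refl
      ... | false = refl

    sumOver-* : ∀ (t : ℚ) (f : Fin n → ℚ) → sumOver P (λ v → t * f v) ≡ t * sumOver P f
    sumOver-* t f = begin
      sumOver P (λ v → t * f v)           ≡⟨ sumOver≡sum P _ ⟩
      sum (restrict P (λ v → t * f v))    ≡⟨ ℚΣ.sum-cong-≗ pointwise ⟩
      sum (λ v → t * restrict P f v)      ≡⟨ ℚΣ.*-distribˡ-sum t (restrict P f) ⟨
      t * sum (restrict P f)              ≡⟨ cong (t *_) (sumOver≡sum P f) ⟨
      t * sumOver P f                     ∎
      where
      open ≡-Reasoning
      pointwise : ∀ u → restrict P (λ v → t * f v) u ≡ t * restrict P f u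
      pointwise u with P u
      ... | true  = refl
      ... | false = sym (ℚP.*-zeroʳ t)

    sumOver-nonneg : ∀ {f : Fin n → ℚ} → (∀ u → 0ℚ ≤ f u) → 0ℚ ≤ sumOver P f
    sumOver-nonneg {f} 0≤f = subst (0ℚ ≤_) (sym (sumOver≡sum P f)) (sum-nonneg (restrict-nonneg 0≤f))

  sumOver-remove : ∀ {n} (P : Fin (suc n) → Bool) (f : Fin (suc n) → ℚ) (w : Fin (suc n)) →
                   sumOver P f ≡ restrict P f w + sum (removeAt (restrict P f) w)
  sumOver-remove P f w = trans (sumOver≡sum P f) (ℚΣ.sum-remove (restrict P f))

  sumOver-⊆ : ∀ {n} {P Q : Fin n → Bool} {f : Fin n → ℚ} {w : Fin n} → (∀ u → 0ℚ ≤ f u) →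
              (∀ u → T (P u) → T (Q u)) → ¬ T (P w) → T (Q w) → sumOver P f + f w ≤ sumOver Q f
  sumOver-⊆ {suc n} {P} {Q} {f} {w} 0≤f P⊆Q ¬Pw Qw = begin
    sumOver P f + f w                  ≡⟨ cong (_+ f w) (sumOver-remove P f w) ⟩
    (restrict P f w + rest P) + f w    ≡⟨ cong (λ z → (z + rest P) + f w) (restrict-F P f ¬Pw) ⟩
    (0ℚ + rest P) + f w                ≡⟨ cong (_+ f w) (ℚP.+-identityˡ (rest P)) ⟩
    rest P + f w                       ≡⟨ ℚP.+-comm (rest P) (f w) ⟩
    f w + rest P                       ≤⟨ ℚP.+-monoʳ-≤ (f w) (sum-mono-≤ (restrict-≤ ∘ punchIn w)) ⟩
    f w + rest Q                       ≡⟨ cong (_+ rest Q) (restrict-T Q f Qw) ⟨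
    restrict Q f w + rest Q            ≡⟨ sumOver-remove Q f w ⟨
    sumOver Q f                        ∎
    where
    open ℚP.≤-Reasoning
    rest : (Fin (suc n) → Bool) → ℚ
    rest R = sum (removeAt (restrict R f) w)
    restrict-≤ : ∀ u → restrict P f u ≤ restrict Q f u
    restrict-≤ u with P u in Pu
    ... | true  = ℚP.≤-reflexive (sym (restrict-T Q f (P⊆Q u (subst T (sym Pu) tt))))
    ... | false = restrict-nonneg Q 0≤f u

  ZeroOrAtLeastOne : ℚ → Set
  ZeroOrAtLeastOne q = q ≡ 0ℚ ⊎ 1ℚ ≤ q

  sum-zeroOrAtLeastOne : ∀ {n} {f : Fin n → ℚ} → (∀ i → ZeroOrAtLeastOne (f i)) → ZeroOrAtLeastOne (sum f)
  sum-zeroOrAtLeastOne {zero}      _  = inj₁ refl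
  sum-zeroOrAtLeastOne {suc n} {f} fᵢ with fᵢ zero | sum-zeroOrAtLeastOne (fᵢ ∘ suc)
  ... | inj₁ f₀≡0 | inj₁ rest≡0 = inj₁ (cong₂ _+_ f₀≡0 rest≡0)
  ... | inj₁ f₀≡0 | inj₂ rest≥1 =
    inj₂ (subst (1ℚ ≤_) (sym (trans (cong (_+ sum (f ∘ suc)) f₀≡0) (ℚP.+-identityˡ (sum (f ∘ suc))))) rest≥1)
  ... | inj₂ f₀≥1 | rest =
    inj₂ (ℚP.≤-trans (ℚP.≤-reflexive (sym (ℚP.+-identityʳ 1ℚ))) (ℚP.+-mono-≤ f₀≥1 (nonneg rest)))
    where
    nonneg : ∀ {q} → ZeroOrAtLeastOne q → 0ℚ ≤ q
    nonneg (inj₁ refl) = ℚP.≤-refl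
    nonneg (inj₂ q≥1)  = ℚP.≤-trans (ℚP.<⇒≤ (ℚP.positive⁻¹ 1ℚ)) q≥1

  sumOver-term+zeroOrAtLeastOne : ∀ {n} (P : Fin n → Bool) (f : Fin n → ℚ) {w} → T (P w) →
                                  (∀ u → u ≢ w → T (P u) → ZeroOrAtLeastOne (f u)) →
                                  ∃ λ r → ZeroOrAtLeastOne r × sumOver P f ≡ f w + r
  sumOver-term+zeroOrAtLeastOne {suc n} P f {w} Pw others =
    sum (removeAt (restrict P f) w) , sum-zeroOrAtLeastOne rest ,
    trans (sumOver-remove P f w) (cong (_+ sum (removeAt (restrict P f) w)) (restrict-T P f Pw))
    where
    rest : ∀ k → ZeroOrAtLeastOne (restrict P f (punchIn w k))
    rest k with P (punchIn w k) in Pᵤ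
    ... | true  = others (punchIn w k) (FinP.punchInᵢ≢i w k) (subst T (sym Pᵤ) tt)
    ... | false = inj₁ refl


module Linear where
  open import Data.Rational using (_+_; _*_; _-_; -_)
  open import Data.Rational.Solver using (module +-*-Solver)
  open +-*-Solver
  open Sums

  record LinearForm (n : ℕ) : Set where
    field
      apply      : (Fin n → ℚ) → ℚ
      apply-cong : ∀ {a b : Fin n → ℚ} → (∀ i → a i ≡ b i) → apply a ≡ apply b
      apply-+    : ∀ (a b : Fin n → ℚ) → apply (λ i → a i + b i) ≡ apply a + apply b
      apply-*    : ∀ (s : ℚ) (a : Fin n → ℚ) → apply (λ i → s * a i) ≡ s * apply a
  open LinearForm public

  unitVector : ∀ {n} → Fin n → Fin n → ℚ
  unitVector zero    zero    = 1ℚ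
  unitVector zero    (suc _) = 0ℚ
  unitVector (suc _) zero    = 0ℚ
  unitVector (suc i) (suc j) = unitVector i j

  unitVector-punchIn : ∀ {n} (i : Fin (suc n)) (j : Fin n) → unitVector i (punchIn i j) ≡ 0ℚ
  unitVector-punchIn zero    j       = refl
  unitVector-punchIn (suc i) zero    = refl
  unitVector-punchIn (suc i) (suc j) = unitVector-punchIn i j

  restrictToTail : ∀ {n} → LinearForm (suc n) → LinearForm n
  restrictToTail φ = record
    { apply      = λ b → apply φ (0ℚ Vector.∷ b)
    ; apply-cong = λ a≗b → apply-cong φ λ { zero → refl ; (suc j) → a≗b j }
    ; apply-+    = λ a b → trans (apply-cong φ λ { zero → refl ; (suc j) → refl })
                                 (apply-+ φ (0ℚ Vector.∷ a) (0ℚ Vector.∷ b))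
    ; apply-*    = λ s a → trans (apply-cong φ λ { zero → sym (ℚP.*-zeroʳ s) ; (suc j) → refl })
                                 (apply-* φ s (0ℚ Vector.∷ a))
    }

  vanishes-on-units⇒zero : ∀ {n} (φ : LinearForm n) → (∀ i → apply φ (unitVector i) ≡ 0ℚ) →
                           ∀ a → apply φ a ≡ 0ℚ
  vanishes-on-units⇒zero {zero} φ _ a = begin
    apply φ a                    ≡⟨ apply-cong φ (λ ()) ⟩
    apply φ (λ i → 0ℚ * a i)     ≡⟨ apply-* φ 0ℚ a ⟩
    0ℚ * apply φ a               ≡⟨ ℚP.*-zeroˡ (apply φ a) ⟩
    0ℚ                           ∎
    where open ≡-Reasoning
  vanishes-on-units⇒zero {suc n} φ φ-kills-units a = begin
    apply φ a                                                   ≡⟨ apply-cong φ decompose ⟩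
    apply φ (λ i → a zero * unitVector zero i + tail₀ i)        ≡⟨ apply-+ φ _ tail₀ ⟩
    apply φ (λ i → a zero * unitVector zero i) + apply φ tail₀  ≡⟨ cong₂ _+_ (apply-* φ (a zero) (unitVector zero))
                                                                     (vanishes-on-units⇒zero (restrictToTail φ) tailUnits (a ∘ suc)) ⟩
    a zero * apply φ (unitVector zero) + 0ℚ                     ≡⟨ cong (λ z → a zero * z + 0ℚ) (φ-kills-units zero) ⟩
    a zero * 0ℚ + 0ℚ                                            ≡⟨ solve 1 (λ x → x :* con 0ℚ :+ con 0ℚ := con 0ℚ) refl (a zero) ⟩
    0ℚ                                                          ∎
    where
    open ≡-Reasoning
    tail₀ : Fin (suc n) → ℚ
    tail₀ = 0ℚ Vector.∷ (a ∘ suc)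
    decompose : ∀ i → a i ≡ a zero * unitVector zero i + tail₀ i
    decompose zero    = solve 1 (λ x → x := x :* con 1ℚ :+ con 0ℚ) refl (a zero)
    decompose (suc j) = solve 2 (λ x y → y := x :* con 0ℚ :+ y) refl (a zero) (a (suc j))
    tailUnits : ∀ i → apply (restrictToTail φ) (unitVector i) ≡ 0ℚ
    tailUnits i = trans (apply-cong φ λ { zero → refl ; (suc j) → refl }) (φ-kills-units (suc i))

  punchIn-view : ∀ {n} (i j : Fin (suc n)) → i ≡ j ⊎ ∃ λ k → punchIn i k ≡ j
  punchIn-view i j with i FinP.≟ j
  ... | yes i≡j = inj₁ i≡j
  ... | no  i≢j = inj₂ (Fin.punchOut i≢j , FinP.punchIn-punchOut i≢j)

  module Pivot {n : ℕ} (φ : LinearForm (suc n)) (i : Fin (suc n)) (φeᵢ≢0 : apply φ (unitVector i) ≢ 0ℚ) where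

    c : ℚ
    c = apply φ (unitVector i)

    instance
      c-nonZero : ℚ.NonZero c
      c-nonZero = ℚ.≢-nonZero φeᵢ≢0

    embed : (Fin n → ℚ) → Fin (suc n) → ℚ
    embed b = insertAt b i 0ℚ

    embed-cong : ∀ {a b : Fin n → ℚ} → (∀ k → a k ≡ b k) → ∀ j → embed a j ≡ embed b j
    embed-cong {a} {b} a≗b j with punchIn-view i j
    ... | inj₁ refl     = trans (insertAt-lookup a i 0ℚ) (sym (insertAt-lookup b i 0ℚ))
    ... | inj₂ (k , refl) = trans (insertAt-punchIn a i 0ℚ k) (trans (a≗b k) (sym (insertAt-punchIn b i 0ℚ k)))

    embed-+ : ∀ (a b : Fin n → ℚ) j → embed (λ k → a k + b k) j ≡ embed a j + embed b j
    embed-+ a b j with punchIn-view i j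
    ... | inj₁ refl rewrite insertAt-lookup (λ k → a k + b k) i 0ℚ
                          | insertAt-lookup a i 0ℚ | insertAt-lookup b i 0ℚ = refl
    ... | inj₂ (k , refl) rewrite insertAt-punchIn (λ k → a k + b k) i 0ℚ k
                                | insertAt-punchIn a i 0ℚ k | insertAt-punchIn b i 0ℚ k = refl

    embed-* : ∀ (s : ℚ) (a : Fin n → ℚ) j → embed (λ k → s * a k) j ≡ s * embed a j
    embed-* s a j with punchIn-view i j
    ... | inj₁ refl rewrite insertAt-lookup (λ k → s * a k) i 0ℚ
                          | insertAt-lookup a i 0ℚ = sym (ℚP.*-zeroʳ s)
    ... | inj₂ (k , refl) rewrite insertAt-punchIn (λ k → s * a k) i 0ℚ k
                                | insertAt-punchIn a i 0ℚ k = refl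

    -- The i-th coordinate is chosen so that φ vanishes on the lift.
    height : (Fin n → ℚ) → ℚ
    height b = - (apply φ (embed b) * ℚ.1/ c)

    lift : (Fin n → ℚ) → Fin (suc n) → ℚ
    lift b j = embed b j + height b * unitVector i j

    apply-lift : ∀ b → apply φ (lift b) ≡ 0ℚ
    apply-lift b = begin
      apply φ (lift b)                                   ≡⟨ apply-+ φ (embed b) _ ⟩
      apply φ (embed b) + apply φ (λ j → height b * unitVector i j) ≡⟨ cong (apply φ (embed b) +_) (apply-* φ (height b) _) ⟩
      apply φ (embed b) + height b * c                   ≡⟨ solve 3 (λ x y z → x :+ (:- (x :* y)) :* z := x :- x :* (y :* z))
                                                                   refl (apply φ (embed b)) (ℚ.1/ c) c ⟩
      apply φ (embed b) - apply φ (embed b) * (ℚ.1/ c * c) ≡⟨ cong (λ z → apply φ (embed b) - apply φ (embed b) * z)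
                                                                   (ℚP.*-inverseˡ c) ⟩
      apply φ (embed b) - apply φ (embed b) * 1ℚ           ≡⟨ solve 1 (λ x → x :- x :* con 1ℚ := con 0ℚ)
                                                                   refl (apply φ (embed b)) ⟩
      0ℚ                                                   ∎
      where open ≡-Reasoning

    lift-punchIn : ∀ b k → lift b (punchIn i k) ≡ b k
    lift-punchIn b k rewrite insertAt-punchIn b i 0ℚ k | unitVector-punchIn i k =
      solve 2 (λ x y → x :+ y :* con 0ℚ := x) refl (b k) (height b)

    height-+ : ∀ a b → height (λ k → a k + b k) ≡ height a + height b
    height-+ a b rewrite apply-cong φ (embed-+ a b) | apply-+ φ (embed a) (embed b) =
      solve 3 (λ x y z → :- ((x :+ y) :* z) := :- (x :* z) :+ :- (y :* z)) refl (apply φ (embed a)) (apply φ (embed b)) (ℚ.1/ c)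

    height-* : ∀ s a → height (λ k → s * a k) ≡ s * height a
    height-* s a rewrite apply-cong φ (embed-* s a) | apply-* φ s (embed a) =
      solve 3 (λ s x z → :- ((s :* x) :* z) := s :* :- (x :* z)) refl s (apply φ (embed a)) (ℚ.1/ c)

    lift-cong : ∀ {a b : Fin n → ℚ} → (∀ k → a k ≡ b k) → ∀ j → lift a j ≡ lift b j
    lift-cong a≗b j = cong₂ (λ e h → e + h * unitVector i j) (embed-cong a≗b j)
                            (cong (λ z → - (z * ℚ.1/ c)) (apply-cong φ (embed-cong a≗b)))

    lift-+ : ∀ a b j → lift (λ k → a k + b k) j ≡ lift a j + lift b j
    lift-+ a b j rewrite embed-+ a b j | height-+ a b =
      solve 5 (λ x y u v e → x :+ y :+ (u :+ v) :* e := x :+ u :* e :+ (y :+ v :* e)) refl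
        (embed a j) (embed b j) (height a) (height b) (unitVector i j)

    lift-* : ∀ s a j → lift (λ k → s * a k) j ≡ s * lift a j
    lift-* s a j rewrite embed-* s a j | height-* s a =
      solve 4 (λ s x u e → s :* x :+ s :* u :* e := s :* (x :+ u :* e)) refl s (embed a j) (height a) (unitVector i j)

    pullback : LinearForm (suc n) → LinearForm n
    pullback ψ = record
      { apply      = λ b → apply ψ (lift b)
      ; apply-cong = λ a≗b → apply-cong ψ (lift-cong a≗b)
      ; apply-+    = λ a b → trans (apply-cong ψ (lift-+ a b)) (apply-+ ψ (lift a) (lift b))
      ; apply-*    = λ s a → trans (apply-cong ψ (lift-* s a)) (apply-* ψ s (lift a))
      }

  Kernel : ∀ {n} → List (LinearForm n) → Set
  Kernel {n} φs = ∃ λ (α : Fin n → ℚ) → (∃ λ i → α i ≢ 0ℚ) × All (λ φ → apply φ α ≡ 0ℚ) φs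

  -- Gaussian elimination: the first form either vanishes identically or can be solved for one coordinate.
  nontrivial-kernel : ∀ r {n} (φs : List (LinearForm n)) → length φs ≡ r → r ℕ.< n → Kernel φs
  nontrivial-kernel zero    {suc n} []       _      _         = (λ _ → 1ℚ) , (zero , λ ()) , []
  nontrivial-kernel (suc r) {suc n} (φ ∷ ψs) |φs|≡r (s≤s r<n) = extend (FinP.any? (λ i → ¬? (apply φ (unitVector i) ℚP.≟ 0ℚ)))
    where
    |ψs|≡r : length ψs ≡ r
    |ψs|≡r = ℕP.suc-injective |φs|≡r
    extend : Dec (∃ λ i → apply φ (unitVector i) ≢ 0ℚ) → Kernel (φ ∷ ψs)
    extend (yes (i , φeᵢ≢0)) = liftKernel (nontrivial-kernel r (List.map pullback ψs) (trans (length-map pullback ψs) |ψs|≡r) r<n)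
      where
      open Pivot φ i φeᵢ≢0
      liftKernel : Kernel (List.map pullback ψs) → Kernel (φ ∷ ψs)
      liftKernel (β , (k , βₖ≢0) , ψsβ) =
        lift β , (punchIn i k , βₖ≢0 ∘ trans (sym (lift-punchIn β k))) , apply-lift β ∷ AllP.map⁻ ψsβ
    extend (no ¬∃) = extendByZero (nontrivial-kernel r ψs |ψs|≡r (ℕP.m<n⇒m<1+n r<n))
      where
      φ-kills-units : ∀ i → apply φ (unitVector i) ≡ 0ℚ
      φ-kills-units i with apply φ (unitVector i) ℚP.≟ 0ℚ
      ... | yes φeᵢ≡0 = φeᵢ≡0
      ... | no  φeᵢ≢0 = ⊥-elim (¬∃ (i , φeᵢ≢0))
      extendByZero : Kernel ψs → Kernel (φ ∷ ψs)
      extendByZero (α , α≢0 , ψsα) = α , α≢0 , vanishes-on-units⇒zero φ φ-kills-units α ∷ ψsα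

  record LinearMap (n : ℕ) : Set where
    field
      map      : (Fin n → ℚ) → Fin n → ℚ
      map-cong : ∀ {a b : Fin n → ℚ} → (∀ i → a i ≡ b i) → ∀ i → map a i ≡ map b i
      map-+    : ∀ (a b : Fin n → ℚ) i → map (λ j → a j + b j) i ≡ map a i + map b i
      map-*    : ∀ (s : ℚ) (a : Fin n → ℚ) i → map (λ j → s * a j) i ≡ s * map a i
  open LinearMap public

  _∘ₗ_ : ∀ {n} → LinearForm n → LinearMap n → LinearForm n
  φ ∘ₗ A = record
    { apply      = λ a → apply φ (map A a)
    ; apply-cong = λ a≗b → apply-cong φ (map-cong A a≗b)
    ; apply-+    = λ a b → trans (apply-cong φ (map-+ A a b)) (apply-+ φ (map A a) (map A b))
    ; apply-*    = λ s a → trans (apply-cong φ (map-* A s a)) (apply-* φ s (map A a))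
    }

  apply-shift : ∀ {n} (φ : LinearForm n) (f g : Fin n → ℚ) (t : ℚ) →
                apply φ (λ v → f v + t * g v) ≡ apply φ f + t * apply φ g
  apply-shift φ f g t = trans (apply-+ φ f (λ v → t * g v)) (cong (apply φ f +_) (apply-* φ t g))

  evalForm : ∀ {n} → Fin n → LinearForm n
  evalForm u = record { apply = λ a → a u ; apply-cong = λ a≗b → a≗b u ; apply-+ = λ _ _ → refl ; apply-* = λ _ _ → refl }

  sumOverForm : ∀ {n} → (Fin n → Bool) → LinearForm n
  sumOverForm P = record
    { apply      = sumOver P
    ; apply-cong = λ a≗b → sumOver-cong P λ u _ → a≗b u
    ; apply-+    = sumOver-+ P
    ; apply-*    = sumOver-* P
    }

  weightForm : ∀ {n} → (Fin n → ℕ) → LinearForm n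
  weightForm {n} l = record
    { apply      = weight l
    ; apply-cong = λ a≗b → sumOver-cong all λ u _ → cong (q u *_) (a≗b u)
    ; apply-+    = λ a b → trans (sumOver-cong all λ u _ → ℚP.*-distribˡ-+ (q u) (a u) (b u))
                                 (sumOver-+ all (λ u → q u * a u) (λ u → q u * b u))
    ; apply-*    = λ s a → trans (sumOver-cong all λ u _ → solve 3 (λ q s a → q :* (s :* a) := s :* (q :* a)) refl (q u) s (a u))
                                 (sumOver-* all s (λ u → q u * a u))
    }
    where
    all : Fin n → Bool
    all _ = true
    q : Fin n → ℚ
    q u = (ℤ.+ l u) ℚ./ 1

module SmallSteps where
  open import Data.Rational using (_+_; _*_; _-_; -_; _≤_; _<_)
  open import Algebra.Properties.CommutativeSemigroup (CommutativeMonoid.commutativeSemigroup ℚP.+-0-commutativeMonoid)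
    using () renaming (interchange to +-interchange)
  open import Data.Rational.Solver using (module +-*-Solver)
  open +-*-Solver

  Eventually : (ℚ → Set) → Set
  Eventually P = ∃ λ δ → 0ℚ < δ × (∀ ε → 0ℚ < ε → ε ≤ δ → P ε)

  private
    variable
      A : Set
      P Q : ℚ → Set

  eventually-positive : (∀ ε → 0ℚ < ε → P ε) → Eventually P
  eventually-positive P-pos = 1ℚ , ℚP.positive⁻¹ 1ℚ , λ ε ε>0 _ → P-pos ε ε>0

  eventually-witness : Eventually P → ∃ λ ε → 0ℚ < ε × P ε
  eventually-witness (δ , δ>0 , P-below) = δ , δ>0 , P-below δ δ>0 ℚP.≤-refl

  eventually-map : (∀ {ε} → P ε → Q ε) → Eventually P → Eventually Q
  eventually-map P⇒Q (δ , δ>0 , P-below) = δ , δ>0 , λ ε ε>0 ε≤δ → P⇒Q (P-below ε ε>0 ε≤δ)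

  eventually-× : Eventually P → Eventually Q → Eventually (λ ε → P ε × Q ε)
  eventually-× (δ , δ>0 , P-below) (δ′ , δ′>0 , Q-below) = δ ℚ.⊓ δ′ , δ⊓δ′>0 , λ ε ε>0 ε≤δ⊓δ′ →
    P-below ε ε>0 (ℚP.≤-trans ε≤δ⊓δ′ (ℚP.p⊓q≤p δ δ′)) ,
    Q-below ε ε>0 (ℚP.≤-trans ε≤δ⊓δ′ (ℚP.p⊓q≤q δ δ′))
    where
    δ⊓δ′>0 : 0ℚ < δ ℚ.⊓ δ′
    δ⊓δ′>0 with ℚP.⊓-sel δ δ′
    ... | inj₁ δ⊓δ′≡δ  = subst (0ℚ <_) (sym δ⊓δ′≡δ) δ>0
    ... | inj₂ δ⊓δ′≡δ′ = subst (0ℚ <_) (sym δ⊓δ′≡δ′) δ′>0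

  eventually-→ : Dec A → (A → Eventually P) → Eventually (λ ε → A → P ε)
  eventually-→ (yes a) P-if = eventually-map (λ Pε _ → Pε) (P-if a)
  eventually-→ (no ¬a) _    = eventually-positive λ _ _ a → ⊥-elim (¬a a)

  eventually-∀ : ∀ {n} {P : Fin n → ℚ → Set} → (∀ i → Eventually (P i)) → Eventually (λ ε → ∀ i → P i ε)
  eventually-∀ {zero}  _    = eventually-positive λ _ _ ()
  eventually-∀ {suc n} P-ev = eventually-map (λ { (P₀ , Pₛ) → λ { zero → P₀ ; (suc i) → Pₛ i } })
                                             (eventually-× (P-ev zero) (eventually-∀ (P-ev ∘ suc)))

  0≤-of-≤ : ∀ {p q} → p ≤ q → 0ℚ ≤ q - p
  0≤-of-≤ {p} {q} p≤q = subst (_≤ q - p) (ℚP.+-inverseʳ p) (ℚP.+-monoˡ-≤ (- p) p≤q)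

  eventually-nonneg : ∀ {s} (a : ℚ) → 0ℚ < s → Eventually (λ ε → 0ℚ ≤ s + ε * a)
  eventually-nonneg {s} a s>0 with 0ℚ ℚP.≤? a
  ... | yes a≥0 = eventually-positive λ ε ε>0 →
    ℚP.+-mono-≤ (ℚP.<⇒≤ s>0)
                (subst (_≤ ε * a) (ℚP.*-zeroʳ ε) (ℚP.*-monoˡ-≤-nonNeg ε {{ℚ.nonNegative (ℚP.<⇒≤ ε>0)}} a≥0))
  ... | no  a≱0 = δ , δ>0 , λ ε ε>0 ε≤δ → subst (0ℚ ≤_) (cong (s +_) (-ε*b≡ε*a ε)) (0≤-of-≤ (ε*b≤s ε ε>0 ε≤δ))
    where
    b : ℚ
    b = - a
    instance
      b-positive : ℚ.Positive b
      b-positive = ℚ.positive (ℚP.neg-antimono-< (ℚP.≰⇒> a≱0))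
      s-positive : ℚ.Positive s
      s-positive = ℚ.positive s>0
      b-nonZero : ℚ.NonZero b
      b-nonZero = ℚP.pos⇒nonZero b
      1/b-positive : ℚ.Positive (ℚ.1/ b)
      1/b-positive = ℚP.1/pos⇒pos b
    δ : ℚ
    δ = s * ℚ.1/ b
    δ>0 : 0ℚ < δ
    δ>0 = ℚP.positive⁻¹ δ {{ℚP.pos*pos⇒pos s (ℚ.1/ b)}}
    ε*b≤s : ∀ ε → 0ℚ < ε → ε ≤ δ → ε * b ≤ s
    ε*b≤s ε ε>0 ε≤δ = begin
      ε * b              ≤⟨ ℚP.*-monoʳ-≤-nonNeg b {{ℚ.nonNegative (ℚP.<⇒≤ (ℚP.positive⁻¹ b))}} ε≤δ ⟩
      s * ℚ.1/ b * b     ≡⟨ ℚP.*-assoc s (ℚ.1/ b) b ⟩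
      s * (ℚ.1/ b * b)   ≡⟨ cong (s *_) (ℚP.*-inverseˡ b) ⟩
      s * 1ℚ             ≡⟨ ℚP.*-identityʳ s ⟩
      s                  ∎
      where open ℚP.≤-Reasoning
    -ε*b≡ε*a : ∀ ε → - (ε * b) ≡ ε * a
    -ε*b≡ε*a ε = solve 2 (λ e a → :- (e :* (:- a)) := e :* a) refl ε a

  -- g is the slack of a constraint and L its rate of change along a direction.
  eventually-slack : ∀ {g L} → 0ℚ ≤ g → (g ≡ 0ℚ → L ≡ 0ℚ) →
                     Eventually (λ ε → 0ℚ ≤ g + ε * L × 0ℚ ≤ g + (- ε) * L)
  eventually-slack {g} {L} g≥0 flat with ℚP.<-cmp 0ℚ g
  ... | tri< g>0 _ _ = eventually-map (λ {ε} → λ { (lower , upper) → lower , subst (0ℚ ≤_) (cong (g +_) (ε*-L≡-ε*L ε)) upper })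
                                      (eventually-× (eventually-nonneg L g>0) (eventually-nonneg (- L) g>0))
    where
    ε*-L≡-ε*L : ∀ ε → ε * (- L) ≡ (- ε) * L
    ε*-L≡-ε*L ε = solve 2 (λ e l → e :* (:- l) := (:- e) :* l) refl ε L
  ... | tri≈ _ 0≡g _ rewrite sym 0≡g | flat refl = eventually-positive λ ε _ → 0≤0+t*0 ε , 0≤0+t*0 (- ε)
    where
    0≤0+t*0 : ∀ t → 0ℚ ≤ 0ℚ + t * 0ℚ
    0≤0+t*0 t = ℚP.≤-reflexive (solve 1 (λ t → con 0ℚ := con 0ℚ :+ t :* con 0ℚ) refl t)
  ... | tri> _ _ g<0 = ⊥-elim (ℚP.<-irrefl refl (ℚP.<-≤-trans g<0 g≥0))

  Moved : ℚ → ℚ → ℚ → ℚ → ℚ → Set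
  Moved t a da b db = a + t * da ≤ b + t * db

  Moved± : ℚ → ℚ → ℚ → ℚ → ℚ → Set
  Moved± ε a da b db = Moved ε a da b db × Moved (- ε) a da b db

  -+-cancel : ∀ p q → q - p + p ≡ q
  -+-cancel p q = trans (ℚP.+-assoc q (- p) p) (trans (cong (q +_) (ℚP.+-inverseˡ p)) (ℚP.+-identityʳ q))

  ≤-of-0≤- : ∀ {p q} → 0ℚ ≤ q - p → p ≤ q
  ≤-of-0≤- {p} {q} 0≤q-p = subst₂ _≤_ (ℚP.+-identityˡ p) (-+-cancel p q) (ℚP.+-monoˡ-≤ p 0≤q-p)

  slack-along : ∀ a da b db t → (b - a) + t * (db - da) ≡ (b + t * db) - (a + t * da)
  slack-along a da b db t = begin
    (b - a) + t * (db - da)           ≡⟨ cong ((b - a) +_) (trans (ℚP.*-distribˡ-+ t db (- da))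
                                                                   (cong (t * db +_) (sym (ℚP.neg-distribʳ-* t da)))) ⟩
    (b - a) + (t * db - t * da)       ≡⟨ +-interchange b (- a) (t * db) (- (t * da)) ⟩
    (b + t * db) + (- a - t * da)     ≡⟨ cong ((b + t * db) +_) (ℚP.neg-distrib-+ a (t * da)) ⟨
    (b + t * db) - (a + t * da)       ∎
    where open ≡-Reasoning

  eventually-moved : ∀ {a da b db} → a ≤ b → (a ≡ b → da ≡ db) → Eventually (λ ε → Moved± ε a da b db)
  eventually-moved {a} {da} {b} {db} a≤b flat =
    eventually-map (λ {ε} → λ { (moved⁺ , moved⁻) → ≤-of-slack ε moved⁺ , ≤-of-slack (- ε) moved⁻ })
                   (eventually-slack (0≤-of-≤ a≤b) λ b-a≡0 →
                     trans (cong (λ z → db - z) (flat (≡-of-diff b-a≡0))) (ℚP.+-inverseʳ db))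
    where
    ≡-of-diff : b - a ≡ 0ℚ → a ≡ b
    ≡-of-diff b-a≡0 = sym (trans (sym (-+-cancel a b)) (trans (cong (_+ a) b-a≡0) (ℚP.+-identityˡ a)))
    ≤-of-slack : ∀ t → 0ℚ ≤ (b - a) + t * (db - da) → Moved t a da b db
    ≤-of-slack t 0≤slack = ≤-of-0≤- (subst (0ℚ ≤_) (slack-along a da b db t) 0≤slack)

  +-*-zeroʳ : ∀ p t → p + t * 0ℚ ≡ p
  +-*-zeroʳ p t = solve 2 (λ p t → p :+ t :* con 0ℚ := p) refl p t

  cancel-opposite : ∀ {a d ε} → 0ℚ < ε → a + ε * d ≡ a + (- ε) * d → d ≡ 0ℚ
  cancel-opposite {a} {d} {ε} ε>0 eq = begin
    d                                   ≡⟨ solve 1 (λ d → d := con 1ℚ :* d) refl d ⟩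
    1ℚ * d                              ≡⟨ cong (_* d) (ℚP.*-inverseˡ (ε + ε)) ⟨
    ℚ.1/ (ε + ε) * (ε + ε) * d          ≡⟨ ℚP.*-assoc (ℚ.1/ (ε + ε)) (ε + ε) d ⟩
    ℚ.1/ (ε + ε) * ((ε + ε) * d)        ≡⟨ cong (ℚ.1/ (ε + ε) *_) 2εd≡0 ⟩
    ℚ.1/ (ε + ε) * 0ℚ                   ≡⟨ ℚP.*-zeroʳ (ℚ.1/ (ε + ε)) ⟩
    0ℚ                                  ∎
    where
    open ≡-Reasoning
    instance
      ε-positive : ℚ.Positive ε
      ε-positive = ℚ.positive ε>0
      2ε-nonZero : ℚ.NonZero (ε + ε)
      2ε-nonZero = ℚP.pos⇒nonZero (ε + ε) {{ℚP.pos+pos⇒pos ε ε}}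
    2εd≡0 : (ε + ε) * d ≡ 0ℚ
    2εd≡0 = begin
      (ε + ε) * d                         ≡⟨ solve 3 (λ a e d → (e :+ e) :* d := (a :+ e :* d) :- (a :+ (:- e) :* d)) refl a ε d ⟩
      (a + ε * d) - (a + (- ε) * d)       ≡⟨ cong (_- (a + (- ε) * d)) eq ⟩
      (a + (- ε) * d) - (a + (- ε) * d)   ≡⟨ ℚP.+-inverseʳ (a + (- ε) * d) ⟩
      0ℚ                                  ∎

leavesBelow : ∀ {N} → Graph N → Fin N → Fin N → Bool
leavesBelow E v u = isLeaf E u ∧ inSubtree E v u

leafSum : ∀ {N} → Graph N → Fin N → (Fin N → ℚ) → ℚ
leafSum E v = sumOver (leavesBelow E v)

Fractional : ℚ → Set
Fractional q = 0ℚ ℚ.< q × q ℚ.< 1ℚ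

module Perturbation {N c : ℕ} (E : Graph N) (lam : Fin c → Fin N → ℕ) (k : ℚ) (m : Fin c → ℚ)
                    {x : Fin N → ℚ} (x-extreme : ExtremePoint E lam k m x) where
  open import Data.Rational using (½; _+_; _*_; _-_; -_; _≤_; _<_)
  open import Data.Rational.Solver using (module +-*-Solver)
  open +-*-Solver
  open Sums
  open Linear
  open SmallSteps
  open ExtremePoint x-extreme using (feasible; extreme)
  open Feasible feasible

  shift : ℚ → (Fin N → ℚ) → Fin N → ℚ
  shift t d v = x v + t * d v

  -- A direction that is flat along every constraint that x satisfies with equality.
  record Direction (d : Fin N → ℚ) : Set where
    field
      vanishes-off-fractional : ∀ v → ¬ Fractional (x v) → d v ≡ 0ℚ
      budget-flat  : sumOver (isLeaf E) d ≡ 0ℚ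
      cover-flat   : ∀ i → 1 ℕ.≤ toℕ i → weight (lam i) d ≡ 0ℚ
      subtree-flat : ∀ v → isLeaf E v ≡ false → 0ℚ < x v → x v ≡ leafSum E v x → d v ≡ leafSum E v d

  -- The constraints of the program, each as an inequality a ≤ b with the slopes da and db of its sides along d.
  Constraints : (Fin N → ℚ) → (ℚ → ℚ → ℚ → ℚ → Set) → Set
  Constraints d Holds =
    (∀ v → Holds 0ℚ 0ℚ (x v) (d v)) ×
    (∀ v → Holds (x v) (d v) 1ℚ 0ℚ) ×
    (∀ v → isLeaf E v ≡ false → 0ℚ < x v → Holds (x v) (d v) (leafSum E v x) (leafSum E v d)) ×
    Holds (sumOver (isLeaf E) x) (sumOver (isLeaf E) d) k 0ℚ ×
    (∀ i → 1 ℕ.≤ toℕ i → Holds (m i) 0ℚ (weight (lam i) x) (weight (lam i) d))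

  constraints-map : ∀ {d} {R R′ : ℚ → ℚ → ℚ → ℚ → Set} → (∀ {a da b db} → R a da b db → R′ a da b db) →
                    Constraints d R → Constraints d R′
  constraints-map f (lower , upper , subtree , budget , cover) =
    f ∘ lower , f ∘ upper , (λ v nonleaf xᵥ>0 → f (subtree v nonleaf xᵥ>0)) , f budget , λ i i≥1 → f (cover i i≥1)

  Slack : (Fin N → ℚ) → ℚ → Set
  Slack d t = Constraints d (Moved t)

  module _ {d : Fin N → ℚ} (direction : Direction d) where
    open Direction direction

    feasible-shift : ∀ {t} → Slack d t → Feasible E lam k m (shift t d)
    feasible-shift {t} (lowerBound , upperBound , subtreeBound , budgetBound , coverBound) = record
      { cover  = λ i i≥1 → subst₂ _≤_ (+-*-zeroʳ (m i) t) (sym (apply-shift (weightForm (lam i)) x d t)) (coverBound i i≥1)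
      ; zBound = zBound′
      ; budget = subst₂ _≤_ (sym (apply-shift (sumOverForm (isLeaf E)) x d t)) (+-*-zeroʳ k t) budgetBound
      ; nonneg = nonneg′
      ; le1    = λ v → subst (shift t d v ≤_) (+-*-zeroʳ 1ℚ t) (upperBound v)
      }
      where
      nonneg′ : ∀ v → 0ℚ ≤ shift t d v
      nonneg′ v = subst (_≤ shift t d v) (+-*-zeroʳ 0ℚ t) (lowerBound v)
      zBound′ : ∀ v → isLeaf E v ≡ false → shift t d v ≤ leafSum E v (shift t d)
      zBound′ v nonleaf with 0ℚ ℚP.<? x v
      ... | yes xᵥ>0 = subst (shift t d v ≤_) (sym (apply-shift (sumOverForm (leavesBelow E v)) x d t)) (subtreeBound v nonleaf xᵥ>0)
      ... | no  xᵥ≯0 = subst (_≤ leafSum E v (shift t d)) shiftᵥ≡0 (sumOver-nonneg (leavesBelow E v) nonneg′)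
        where
        xᵥ≡0 : x v ≡ 0ℚ
        xᵥ≡0 = ℚP.≤-antisym (ℚP.≮⇒≥ xᵥ≯0) (nonneg v)
        shiftᵥ≡0 : 0ℚ ≡ shift t d v
        shiftᵥ≡0 = sym (trans (cong₂ (λ a b → a + t * b) xᵥ≡0 (vanishes-off-fractional v (xᵥ≯0 ∘ proj₁)))
                              (+-*-zeroʳ 0ℚ t))

    eventually-two-sided-slack : Eventually (λ ε → Slack d ε × Slack d (- ε))
    eventually-two-sided-slack =
      eventually-map (λ {ε} cs → constraints-map {R = Moved± ε} proj₁ cs , constraints-map {R = Moved± ε} proj₂ cs)
      (eventually-× lower (eventually-× upper (eventually-× subtree (eventually-× budget′ cover′))))
      where
      lower : Eventually (λ ε → ∀ v → Moved± ε 0ℚ 0ℚ (x v) (d v))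
      lower = eventually-∀ λ v → eventually-moved (nonneg v)
                λ 0≡xᵥ → sym (vanishes-off-fractional v λ (xᵥ>0 , _) → ℚP.<-irrefl 0≡xᵥ xᵥ>0)
      upper : Eventually (λ ε → ∀ v → Moved± ε (x v) (d v) 1ℚ 0ℚ)
      upper = eventually-∀ λ v → eventually-moved (le1 v)
                λ xᵥ≡1 → vanishes-off-fractional v λ (_ , xᵥ<1) → ℚP.<-irrefl xᵥ≡1 xᵥ<1
      subtree : Eventually (λ ε → ∀ v → isLeaf E v ≡ false → 0ℚ < x v → Moved± ε (x v) (d v) (leafSum E v x) (leafSum E v d))
      subtree = eventually-∀ λ v → eventually-→ (isLeaf E v Bool.≟ false) λ nonleaf →
                  eventually-→ (0ℚ ℚP.<? x v) λ xᵥ>0 → eventually-moved (zBound v nonleaf) (subtree-flat v nonleaf xᵥ>0)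
      budget′ : Eventually (λ ε → Moved± ε (sumOver (isLeaf E) x) (sumOver (isLeaf E) d) k 0ℚ)
      budget′ = eventually-moved budget λ _ → budget-flat
      cover′ : Eventually (λ ε → ∀ i → 1 ℕ.≤ toℕ i → Moved± ε (m i) 0ℚ (weight (lam i) x) (weight (lam i) d))
      cover′ = eventually-∀ λ i → eventually-→ (1 ℕ.≤? toℕ i) λ i≥1 →
                 eventually-moved (cover i i≥1) λ _ → sym (cover-flat i i≥1)

    direction-vanishes : ∀ v → d v ≡ 0ℚ
    direction-vanishes v = vanishes (eventually-witness eventually-two-sided-slack)
      where
      ½>0 : 0ℚ < ½
      ½>0 = ℚP.positive⁻¹ ½
      ½<1 : ½ < 1ℚ
      ½<1 = ℚ.*<* (ℤ.+<+ (s≤s (s≤s z≤n)))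
      midpoint : ∀ ε u → x u ≡ ½ * shift ε d u + (1ℚ - ½) * shift (- ε) d u
      midpoint ε u = solve 3 (λ a t d → a := con ½ :* (a :+ t :* d) :+ (con 1ℚ :- con ½) :* (a :+ (:- t) :* d)) refl (x u) ε (d u)
      vanishes : (∃ λ ε → 0ℚ < ε × Slack d ε × Slack d (- ε)) → d v ≡ 0ℚ
      vanishes (ε , ε>0 , slack⁺ , slack⁻) = cancel-opposite {x v} ε>0
        (extreme (shift ε d) (shift (- ε) d) ½ (feasible-shift {ε} slack⁺) (feasible-shift { - ε} slack⁻) ½>0 ½<1 (midpoint ε) v)

module Blocks {N : ℕ} {E : Graph N} (forest : IsOutForest E) {x : Fin N → ℚ}
              (nonneg : ∀ v → 0ℚ ℚ.≤ x v) (le1 : ∀ v → x v ℚ.≤ 1ℚ) where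
  open import Data.Rational using (_+_; _≤_; _<_)
  open Sums
  open Subtrees forest

  FractionalLeaf : Fin N → Set
  FractionalLeaf v = T (isLeaf E v) × Fractional (x v)

  fractionalLeaf? : ∀ v → Dec (FractionalLeaf v)
  fractionalLeaf? v = T? (isLeaf E v) ×-dec (0ℚ ℚ.<? x v) ×-dec (x v ℚ.<? 1ℚ)

  Saturated : Fin N → Set
  Saturated v = leafSum E v x ≡ 1ℚ

  -- Of two saturated subtrees sharing a vertex, the smaller one already carries all the leaf mass.
  saturated-laminar : ∀ {v v′ h w} → Saturated v → Saturated v′ → T (inSubtree E v h) → T (inSubtree E v′ h) →
                      T (isLeaf E w) → 0ℚ < x w → T (inSubtree E v′ w) → T (inSubtree E v w)
  saturated-laminar {v} {v′} {h} {w} sat sat′ v∋h v′∋h leaf-w xw>0 v′∋w with subtrees-nested v∋h v′∋h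
  ... | inj₂ v∋v′ = subtree-trans v∋v′ v′∋w
  ... | inj₁ v′∋v with T? (inSubtree E v w)
  ...   | yes v∋w = v∋w
  ...   | no  v∌w = ⊥-elim (ℚP.<-irrefl refl (ℚP.<-≤-trans 1<1+xw 1+xw≤1))
    where
    1<1+xw : 1ℚ < 1ℚ + x w
    1<1+xw = subst (_< 1ℚ + x w) (ℚP.+-identityʳ 1ℚ) (ℚP.+-monoʳ-< 1ℚ xw>0)
    below⊆below′ : ∀ u → T (leavesBelow E v u) → T (leavesBelow E v′ u)
    below⊆below′ u below with Equivalence.to T-∧ below
    ... | leaf-u , v∋u = Equivalence.from T-∧ (leaf-u , subtree-trans v′∋v v∋u)
    1+xw≤1 : 1ℚ + x w ≤ 1ℚ
    1+xw≤1 = subst₂ (λ a b → a + x w ≤ b) sat sat′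
               (sumOver-⊆ nonneg below⊆below′ (v∌w ∘ proj₂ ∘ Equivalence.to T-∧) (Equivalence.from T-∧ (leaf-w , v′∋w)))

  saturated? : ∀ v → Dec (Saturated v)
  saturated? v = leafSum E v x ℚP.≟ 1ℚ

  Linked : Fin N → Fin N → Set
  Linked h w = ∃ λ v → Saturated v × T (inSubtree E v h) × T (inSubtree E v w)

  linked? : ∀ h w → Dec (Linked h w)
  linked? h w = FinP.any? λ v → saturated? v ×-dec T? (inSubtree E v h) ×-dec T? (inSubtree E v w)

  InBlock : Fin N → Fin N → Set
  InBlock h w = FractionalLeaf w × Linked h w

  inBlock? : ∀ h w → Dec (InBlock h w)
  inBlock? h w = fractionalLeaf? w ×-dec linked? h w

  -- A block is represented by its least fractional leaf.
  BlockHead : Fin N → Set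
  BlockHead h = InBlock h h × (∀ w → w Fin.< h → ¬ InBlock h w)

  blockHead? : ∀ h → Dec (BlockHead h)
  blockHead? h = inBlock? h h ×-dec FinP.all? λ w → (toℕ w ℕ.<? toℕ h) →-dec ¬? (inBlock? h w)

  linked-within : ∀ {v h w} → Saturated v → T (inSubtree E v h) → Linked h w → FractionalLeaf w → T (inSubtree E v w)
  linked-within sat v∋h (v′ , sat′ , v′∋h , v′∋w) (leaf-w , xw>0 , _) =
    saturated-laminar sat sat′ v∋h v′∋h leaf-w xw>0 v′∋w

  linked-through : ∀ {h₁ h₂ u} → Linked h₁ u → Linked h₂ u → FractionalLeaf h₂ → Linked h₂ h₁
  linked-through (v₁ , sat₁ , v₁∋h₁ , v₁∋u) (v₂ , sat₂ , v₂∋h₂ , v₂∋u) (leaf-h₂ , xh₂>0 , _) =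
    v₁ , sat₁ , saturated-laminar sat₁ sat₂ v₁∋u v₂∋u leaf-h₂ xh₂>0 v₂∋h₂ , v₁∋h₁

  head-unique : ∀ {h₁ h₂ u} → BlockHead h₁ → BlockHead h₂ → InBlock h₁ u → InBlock h₂ u → h₁ ≡ h₂
  head-unique {h₁} {h₂} ((FLh₁ , _) , least₁) ((FLh₂ , _) , least₂) (_ , h₁~u) (_ , h₂~u) with ℕP.<-cmp (toℕ h₁) (toℕ h₂)
  ... | tri< h₁<h₂ _ _ = ⊥-elim (least₂ h₁ h₁<h₂ (FLh₁ , linked-through h₁~u h₂~u FLh₂))
  ... | tri≈ _ h₁≡h₂ _ = FinP.toℕ-injective h₁≡h₂
  ... | tri> _ _ h₁>h₂ = ⊥-elim (least₁ h₂ h₁>h₂ (FLh₂ , linked-through h₂~u h₁~u FLh₁))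

  -- A saturated subtree has leaf mass exactly 1, so one fractional leaf cannot be alone in it.
  saturated-partner : ∀ {v h} → Saturated v → FractionalLeaf h → T (inSubtree E v h) →
                      ∃ λ w → w ≢ h × FractionalLeaf w × T (inSubtree E v w)
  saturated-partner {v} {h} sat (leaf-h , xh>0 , xh<1) v∋h =
    decide (FinP.any? λ w → ¬? (w FinP.≟ h) ×-dec fractionalLeaf? w ×-dec T? (inSubtree E v w))
    where
    Partner : Set
    Partner = ∃ λ w → w ≢ h × FractionalLeaf w × T (inSubtree E v w)
    others : ¬ Partner → ∀ u → u ≢ h → T (leavesBelow E v u) → ZeroOrAtLeastOne (x u)
    others ¬partner u u≢h below with Equivalence.to T-∧ below | 0ℚ ℚ.<? x u | x u ℚ.<? 1ℚ
    ... | leaf-u , v∋u | yes xu>0 | yes xu<1 = ⊥-elim (¬partner (u , u≢h , (leaf-u , xu>0 , xu<1) , v∋u))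
    ... | _            | no  xu≯0 | _        = inj₁ (ℚP.≤-antisym (ℚP.≮⇒≥ xu≯0) (nonneg u))
    ... | _            | yes _    | no xu≮1  = inj₂ (ℚP.≮⇒≥ xu≮1)
    1<xh+1 : 1ℚ < x h + 1ℚ
    1<xh+1 = subst (_< x h + 1ℚ) (ℚP.+-identityˡ 1ℚ) (ℚP.+-monoˡ-< 1ℚ xh>0)
    mass≢1 : ∀ {r} → ZeroOrAtLeastOne r → leafSum E v x ≢ x h + r
    mass≢1 {r} (inj₁ r≡0) sum≡ =
      ℚP.<-irrefl (sym (trans (sym sat) (trans sum≡ (trans (cong (x h +_) r≡0) (ℚP.+-identityʳ (x h)))))) xh<1
    mass≢1 {r} (inj₂ r≥1) sum≡ = ℚP.<-irrefl (trans (sym sat) sum≡) (ℚP.<-≤-trans 1<xh+1 (ℚP.+-monoʳ-≤ (x h) r≥1))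
    decide : Dec Partner → Partner
    decide (yes partner) = partner
    decide (no ¬partner) with sumOver-term+zeroOrAtLeastOne (leavesBelow E v) x (Equivalence.from T-∧ (leaf-h , v∋h)) (others ¬partner)
    ... | r , r≡0∨r≥1 , sum≡ = ⊥-elim (mass≢1 r≡0∨r≥1 sum≡)

  head-partner : ∀ {h} → BlockHead h → ∃ λ w → w ≢ h × InBlock h w
  head-partner ((FLh , v , sat , v∋h , _) , _) with saturated-partner sat FLh v∋h
  ... | w , w≢h , FLw , v∋w = w , w≢h , FLw , v , sat , v∋h , v∋w

  saturated-head : ∀ {v u} → Saturated v → FractionalLeaf u → T (inSubtree E v u) →
                   ∃ λ h → BlockHead h × T (inSubtree E v h)
  saturated-head {v} sat FLu v∋u with least-witness (λ w → fractionalLeaf? w ×-dec T? (inSubtree E v w)) (FLu , v∋u)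
  ... | h , (FLh , v∋h) , least = h , ((FLh , v , sat , v∋h , v∋h) , not-earlier) , v∋h
    where
    not-earlier : ∀ w → w Fin.< h → ¬ InBlock h w
    not-earlier w w<h (FLw , h~w) = least w w<h (FLw , linked-within sat v∋h h~w FLw)

  inBlockᵇ : Fin N → Fin N → Bool
  inBlockᵇ h w = does (inBlock? h w)

  blockSum : Fin N → (Fin N → ℚ) → ℚ
  blockSum h = sumOver (inBlockᵇ h)

  saturated-leafSum-vanishes : ∀ {v} (α : Fin N → ℚ) → (∀ u → ¬ FractionalLeaf u → α u ≡ 0ℚ) →
                               (∀ h → BlockHead h → blockSum h α ≡ 0ℚ) → Saturated v → leafSum E v α ≡ 0ℚ
  saturated-leafSum-vanishes {v} α α-off blockSum≡0 sat with FinP.any? (λ u → fractionalLeaf? u ×-dec T? (inSubtree E v u))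
  ... | no ∄FL = sumOver-zero (leavesBelow E v) λ u below →
          α-off u λ (leaf-u , frac) → ∄FL (u , (leaf-u , frac) , proj₂ (Equivalence.to T-∧ below))
  ... | yes (u , FLu , v∋u) with saturated-head sat FLu v∋u
  ...   | h , head , v∋h = trans (sumOver-ext (leavesBelow E v) {inBlockᵇ h} {g = α} same-terms) (blockSum≡0 h head)
    where
    same-terms : ∀ w → restrict (leavesBelow E v) α w ≡ restrict (inBlockᵇ h) α w
    same-terms w with fractionalLeaf? w
    ... | no ¬FLw = trans (restrict-zero (leavesBelow E v) α (α-off w ¬FLw)) (sym (restrict-zero (inBlockᵇ h) α (α-off w ¬FLw)))
    ... | yes FLw with T? (inSubtree E v w)
    ...   | yes v∋w = trans (restrict-T (leavesBelow E v) α (Equivalence.from T-∧ (proj₁ FLw , v∋w)))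
                            (sym (restrict-T (inBlockᵇ h) α (witness⇒does (inBlock? h w) (FLw , v , sat , v∋h , v∋w))))
    ...   | no v∌w = trans (restrict-F (leavesBelow E v) α (v∌w ∘ proj₂ ∘ Equivalence.to T-∧))
                           (sym (restrict-F (inBlockᵇ h) α λ inBlock →
                             v∌w (linked-within sat v∋h (proj₂ (does⇒witness (inBlock? h w) inBlock)) FLw)))

  blockHeadᵇ : Fin N → Bool
  blockHeadᵇ h = does (blockHead? h)

  fractionalLeafᵇ : Fin N → Bool
  fractionalLeafᵇ w = does (fractionalLeaf? w)

  heads-double-count : count blockHeadᵇ ℕ.+ count blockHeadᵇ ℕ.≤ count fractionalLeafᵇ
  heads-double-count = double-count blockHeadᵇ fractionalLeafᵇ headOf two-members one-head member-fractional
    where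
    headOf : Fin N → Fin N → Bool
    headOf h w = blockHeadᵇ h ∧ inBlockᵇ h w
    split : ∀ {h w} → T (headOf h w) → BlockHead h × InBlock h w
    split {h} {w} hw with Equivalence.to T-∧ hw
    ... | head , inBlock = does⇒witness (blockHead? h) head , does⇒witness (inBlock? h w) inBlock
    join : ∀ {h w} → BlockHead h → InBlock h w → T (headOf h w)
    join {h} {w} head inBlock = Equivalence.from T-∧ (witness⇒does (blockHead? h) head , witness⇒does (inBlock? h w) inBlock)
    two-members : ∀ {h} → T (blockHeadᵇ h) → ∃₂ λ w w′ → w ≢ w′ × T (headOf h w) × T (headOf h w′)
    two-members {h} isHead with does⇒witness (blockHead? h) isHead
    ... | head with head-partner head
    ...   | w , w≢h , inBlock = w , h , w≢h , join head inBlock , join head (proj₁ head)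
    one-head : ∀ {h h′ w} → T (headOf h w) → T (headOf h′ w) → h ≡ h′
    one-head hw h′w with split hw | split h′w
    ... | head , inBlock | head′ , inBlock′ = head-unique head head′ inBlock inBlock′
    member-fractional : ∀ {h w} → T (headOf h w) → T (fractionalLeafᵇ w)
    member-fractional {w = w} hw = witness⇒does (fractionalLeaf? w) (proj₁ (proj₂ (split hw)))

module FractionalLeafBound {N c′ : ℕ} {E : Graph N} (forest : IsOutForest E) (lam : Fin (suc c′) → Fin N → ℕ)
                           {k : ℚ} {m : Fin (suc c′) → ℚ} {x : Fin N → ℚ} (x-extreme : ExtremePoint E lam k m x) where
  open import Data.Rational using (_+_; _*_; _<_)
  open Sums
  open Linear
  open Feasible (ExtremePoint.feasible x-extreme) using (nonneg; le1)
  open Blocks forest nonneg le1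
  open Perturbation E lam k m x-extreme

  TightFractional : Fin N → Set
  TightFractional v = Fractional (x v) × x v ≡ leafSum E v x

  tightFractional? : ∀ v → Dec (TightFractional v)
  tightFractional? v = ((0ℚ ℚ.<? x v) ×-dec (x v ℚ.<? 1ℚ)) ×-dec (x v ℚP.≟ leafSum E v x)

  -- An internal vertex whose subtree constraint is tight must follow its leaf sum; the others stay put.
  extendFromLeaves : (Fin N → ℚ) → Fin N → ℚ
  extendFromLeaves α v = if isLeaf E v then α v else (if does (tightFractional? v) then leafSum E v α else 0ℚ)

  extend-leaf : ∀ α {v} → T (isLeaf E v) → extendFromLeaves α v ≡ α v
  extend-leaf α {v} leaf with isLeaf E v
  ... | true = refl

  extend-tight : ∀ α {v} → isLeaf E v ≡ false → TightFractional v → extendFromLeaves α v ≡ leafSum E v α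
  extend-tight α {v} nonleaf tight with isLeaf E v | does (tightFractional? v) in tightᵇ
  ... | false | true  = refl
  ... | false | false = ⊥-elim (subst T tightᵇ (witness⇒does (tightFractional? v) tight))

  extend-loose : ∀ α {v} → isLeaf E v ≡ false → ¬ TightFractional v → extendFromLeaves α v ≡ 0ℚ
  extend-loose α {v} nonleaf loose with isLeaf E v | does (tightFractional? v) in tightᵇ
  ... | false | true  = ⊥-elim (loose (does⇒witness (tightFractional? v) (subst T (sym tightᵇ) tt)))
  ... | false | false = refl

  leafSum-extend : ∀ α v → leafSum E v (extendFromLeaves α) ≡ leafSum E v α
  leafSum-extend α v = sumOver-cong (leavesBelow E v) λ u below → extend-leaf α (proj₁ (Equivalence.to T-∧ below))

  extendMap : LinearMap N
  extendMap = record { map = extendFromLeaves ; map-cong = extend-cong ; map-+ = extend-+ ; map-* = extend-* }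
    where
    extend-cong : ∀ {a b : Fin N → ℚ} → (∀ i → a i ≡ b i) → ∀ v → extendFromLeaves a v ≡ extendFromLeaves b v
    extend-cong a≗b v with isLeaf E v | does (tightFractional? v)
    ... | true  | _     = a≗b v
    ... | false | true  = sumOver-cong (leavesBelow E v) λ u _ → a≗b u
    ... | false | false = refl
    extend-+ : ∀ (a b : Fin N → ℚ) v → extendFromLeaves (λ i → a i + b i) v ≡ extendFromLeaves a v + extendFromLeaves b v
    extend-+ a b v with isLeaf E v | does (tightFractional? v)
    ... | true  | _     = refl
    ... | false | true  = sumOver-+ (leavesBelow E v) a b
    ... | false | false = refl
    extend-* : ∀ (s : ℚ) (a : Fin N → ℚ) v → extendFromLeaves (λ i → s * a i) v ≡ s * extendFromLeaves a v
    extend-* s a v with isLeaf E v | does (tightFractional? v)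
    ... | true  | _     = refl
    ... | false | true  = sumOver-* (leavesBelow E v) s a
    ... | false | false = sym (ℚP.*-zeroʳ s)

  nonFractionalLeaves : List (Fin N)
  nonFractionalLeaves = filter (¬? ∘ fractionalLeaf?) (List.allFin N)

  blockHeads : List (Fin N)
  blockHeads = filter blockHead? (List.allFin N)

  coverForm : Fin c′ → LinearForm N
  coverForm j = weightForm (lam (suc j)) ∘ₗ extendMap

  offSupportEquations : List (LinearForm N)
  offSupportEquations = List.map evalForm nonFractionalLeaves

  blockEquations : List (LinearForm N)
  blockEquations = List.map (sumOverForm ∘ inBlockᵇ) blockHeads

  -- The conditions under which extendFromLeaves α is a Direction.
  equations : List (LinearForm N)
  equations = offSupportEquations List.++ (sumOverForm (isLeaf E) ∷ tabulate coverForm List.++ blockEquations)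

  length-equations : length equations ≡ count (not ∘ fractionalLeafᵇ) ℕ.+ suc (c′ ℕ.+ count blockHeadᵇ)
  length-equations = begin
    length equations                                                         ≡⟨ length-++ offSupportEquations ⟩
    length offSupportEquations ℕ.+ suc (length (tabulate coverForm List.++ blockEquations))
                                                                             ≡⟨ cong ((length offSupportEquations ℕ.+_) ∘ suc)
                                                                                  (length-++ (tabulate coverForm)) ⟩
    length offSupportEquations ℕ.+ suc (length (tabulate coverForm) ℕ.+ length blockEquations)
                                                                             ≡⟨ cong₂ (λ a b → a ℕ.+ suc b) |offSupport|
                                                                                  (cong₂ ℕ._+_ (length-tabulate coverForm) |blocks|) ⟩
    count (not ∘ fractionalLeafᵇ) ℕ.+ suc (c′ ℕ.+ count blockHeadᵇ)          ∎
    where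
    open ≡-Reasoning
    |offSupport| : length offSupportEquations ≡ count (not ∘ fractionalLeafᵇ)
    |offSupport| = trans (length-map evalForm nonFractionalLeaves) (length-filter-allFin (¬? ∘ fractionalLeaf?))
    |blocks| : length blockEquations ≡ count blockHeadᵇ
    |blocks| = trans (length-map (sumOverForm ∘ inBlockᵇ) blockHeads) (length-filter-allFin blockHead?)

  fewer-equations : 2 ℕ.* suc c′ ℕ.< count fractionalLeafᵇ → length equations ℕ.< N
  fewer-equations excess = begin-strict
    length equations                                                  ≡⟨ length-equations ⟩
    count (not ∘ fractionalLeafᵇ) ℕ.+ suc (c′ ℕ.+ count blockHeadᵇ)   <⟨ ℕP.+-monoʳ-< (count (not ∘ fractionalLeafᵇ)) fewer ⟩
    count (not ∘ fractionalLeafᵇ) ℕ.+ count fractionalLeafᵇ            ≡⟨ count-complement fractionalLeafᵇ ⟩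
    N                                                                 ∎
    where
    open ℕP.≤-Reasoning
    F H : ℕ
    F = count fractionalLeafᵇ
    H = count blockHeadᵇ
    doubled : 2 ℕ.* suc (c′ ℕ.+ H) ℕ.< 2 ℕ.* F
    doubled = begin-strict
      2 ℕ.* suc (c′ ℕ.+ H)       ≡⟨ ℕP.*-distribˡ-+ 2 (suc c′) H ⟩
      2 ℕ.* suc c′ ℕ.+ 2 ℕ.* H   ≡⟨ cong (λ z → 2 ℕ.* suc c′ ℕ.+ (H ℕ.+ z)) (ℕP.+-identityʳ H) ⟩
      2 ℕ.* suc c′ ℕ.+ (H ℕ.+ H) <⟨ ℕP.+-mono-<-≤ excess heads-double-count ⟩
      F ℕ.+ F                    ≡⟨ cong (F ℕ.+_) (ℕP.+-identityʳ F) ⟨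
      2 ℕ.* F                    ∎
    fewer : suc (c′ ℕ.+ H) ℕ.< F
    fewer = ℕP.*-cancelˡ-< 2 (suc (c′ ℕ.+ H)) F doubled

  module _ {α : Fin N → ℚ} (solves : All (λ φ → apply φ α ≡ 0ℚ) equations) where

    private
      rest : All (λ φ → apply φ α ≡ 0ℚ) (tabulate coverForm List.++ blockEquations)
      rest = All.tail (AllP.++⁻ʳ offSupportEquations solves)

    vanishes-off-fractionalLeaves : ∀ u → ¬ FractionalLeaf u → α u ≡ 0ℚ
    vanishes-off-fractionalLeaves u ¬FLu =
      All.lookup (AllP.map⁻ (AllP.++⁻ˡ offSupportEquations solves))
                 (∈-filter⁺ (¬? ∘ fractionalLeaf?) (∈-allFin u) ¬FLu)

    leaves-balanced : sumOver (isLeaf E) α ≡ 0ℚ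
    leaves-balanced = All.head (AllP.++⁻ʳ offSupportEquations solves)

    covers-balanced : ∀ j → weight (lam (suc j)) (extendFromLeaves α) ≡ 0ℚ
    covers-balanced = AllP.tabulate⁻ (AllP.++⁻ˡ (tabulate coverForm) rest)

    blocks-balanced : ∀ h → BlockHead h → blockSum h α ≡ 0ℚ
    blocks-balanced h head = All.lookup (AllP.map⁻ (AllP.++⁻ʳ (tabulate coverForm) rest)) (∈-filter⁺ blockHead? (∈-allFin h) head)

    extended-direction : Direction (extendFromLeaves α)
    extended-direction = record
      { vanishes-off-fractional = vanishes-off-fractional
      ; budget-flat  = trans (sumOver-cong (isLeaf E) λ u leaf → extend-leaf α leaf) leaves-balanced
      ; cover-flat   = λ { zero () ; (suc j) _ → covers-balanced j }
      ; subtree-flat = subtree-flat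
      }
      where
      vanishes-off-fractional : ∀ v → ¬ Fractional (x v) → extendFromLeaves α v ≡ 0ℚ
      vanishes-off-fractional v ¬frac with T? (isLeaf E v)
      ... | yes leaf    = trans (extend-leaf α leaf) (vanishes-off-fractionalLeaves v (¬frac ∘ proj₂))
      ... | no  nonleaf = extend-loose α (¬T⇒≡false nonleaf) (¬frac ∘ proj₁)
      subtree-flat : ∀ v → isLeaf E v ≡ false → 0ℚ < x v → x v ≡ leafSum E v x →
                     extendFromLeaves α v ≡ leafSum E v (extendFromLeaves α)
      subtree-flat v nonleaf xᵥ>0 tight with x v ℚ.<? 1ℚ
      ... | yes xᵥ<1 = trans (extend-tight α nonleaf ((xᵥ>0 , xᵥ<1) , tight)) (sym (leafSum-extend α v))
      ... | no  xᵥ≮1 = trans (extend-loose α nonleaf (λ ((_ , xᵥ<1) , _) → xᵥ≮1 xᵥ<1))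
                             (sym (trans (leafSum-extend α v)
                               (saturated-leafSum-vanishes α vanishes-off-fractionalLeaves blocks-balanced saturated)))
        where
        saturated : Saturated v
        saturated = trans (sym tight) (ℚP.≤-antisym (le1 v) (ℚP.≮⇒≥ xᵥ≮1))

  excess-impossible : ¬ (2 ℕ.* suc c′ ℕ.< fractionalLeaves E x)
  excess-impossible excess = refute (nontrivial-kernel (length equations) equations refl (fewer-equations excess′))
    where
    excess′ : 2 ℕ.* suc c′ ℕ.< count fractionalLeafᵇ
    excess′ = subst (2 ℕ.* suc c′ ℕ.<_) (length-filter-allFin fractionalLeaf?) excess
    refute : Kernel equations → ⊥
    refute (α , (i , αᵢ≢0) , solves) with fractionalLeaf? i
    ... | no  ¬FLᵢ          = αᵢ≢0 (vanishes-off-fractionalLeaves solves i ¬FLᵢ)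
    ... | yes (leafᵢ , _)   = αᵢ≢0 (trans (sym (extend-leaf α leafᵢ)) (direction-vanishes (extended-direction solves) i))

  fractionalLeaves-bound : fractionalLeaves E x ℕ.≤ 2 ℕ.* suc c′
  fractionalLeaves-bound = ℕP.≮⇒≥ excess-impossible

open import Data.Nat using (_≤_; _*_)

mainTheorem12 : ∀ (N n c : ℕ) (E : Graph N) → IsOutForest E → 1 ≤ c →
                (lam : Fin c → Fin N → ℕ) → (∀ i v → lam i v ≤ n) →
                (k : ℚ) (m : Fin c → ℚ) (x : Fin N → ℚ) →
                ExtremePoint E lam k m x →
                fractionalLeaves E x ≤ 2 * c
mainTheorem12 N n zero     E forest () lam _ k m x x-extreme
mainTheorem12 N n (suc c′) E forest _  lam _ k m x x-extreme = FractionalLeafBound.fractionalLeaves-bound forest lam x-extreme
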